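{- There exists a signed graph with maximum average degree $\frac{14}{5}$ which does not admit a homomorphism to $(K_6,M)$.
   Context: A signed graph $(G,\sigma)$ is a simple graph with a signature $\sigma:E(G)\to\{+,-\}$. A homomorphism of $(G,\sigma)$ to $(H,\pi)$ maps vertices and edges of $G$ to vertices and edges of $H$ preserving adjacencies, incidences, and the sign (product of edge signs, with multiplicity) of every closed walk. $(K_6,M)$ is $K_6$ on vertices $1,\dots,6$ with negative edges $12,34,56$ and all other edges positive. The maximum average degree of $G$ is the maximum of $2|E(H)|/|V(H)|$ over nonempty subgraphs $H$ of $G$. -}

module Defs where

open import Data.Nat using (ℕ; zero; _+_; _*_; _≤_; _<_; _<ᵇ_; _/_)
open import Data.Nat.Properties using (_≟_)
open import Data.Bool using (Bool; true; false; _∧_; not)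
open import Data.Fin using (Fin; toℕ; zero; suc)
open import Data.List using (List; []; _∷_; _++_; [_]; map; concatMap; allFin)
open import Data.Product using (Σ; _×_; _,_; ∃)
open import Data.Unit using (⊤)
open import Relation.Binary.PropositionalEquality using (_≡_; refl)
open import Relation.Nullary using (¬_)
open import Relation.Nullary.Decidable using (⌊_⌋)

data Sign : Set where
  pos neg : Sign

_·_ : Sign → Sign → Sign
pos · s = s
neg · pos = neg
neg · neg = pos

-- A finite simple signed graph on vertex set Fin n.
-- adj is the (symmetric, irreflexive) adjacency relation; σ gives the sign
-- of each edge (values on non-adjacent pairs are irrelevant).
record SignedGraph : Set where
  field
    n       : ℕ
    adj     : Fin n → Fin n → Bool
    adj-sym : ∀ i j → adj i j ≡ adj j i
    adj-irr : ∀ i → adj i i ≡ false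
    σ       : Fin n → Fin n → Sign
    σ-sym   : ∀ i j → σ i j ≡ σ j i

open SignedGraph public

IsWalk : ∀ {n} → (Fin n → Fin n → Bool) → List (Fin n) → Set
IsWalk adj' []           = ⊤
IsWalk adj' (x ∷ [])     = ⊤
IsWalk adj' (x ∷ y ∷ r)  = (adj' x y ≡ true) × IsWalk adj' (y ∷ r)

walkSign : ∀ {n} → (Fin n → Fin n → Sign) → List (Fin n) → Sign
walkSign s []          = pos
walkSign s (x ∷ [])    = pos
walkSign s (x ∷ y ∷ r) = s x y · walkSign s (y ∷ r)

closedSeq : ∀ {n} → Fin n → List (Fin n) → List (Fin n)
closedSeq x r = x ∷ (r ++ [ x ])

-- Homomorphism of signed graphs: a vertex map preserving adjacency
-- (hence inducing the edge map) and the sign of every closed walk.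
record Hom (G H : SignedGraph) : Set where
  field
    φ        : Fin (n G) → Fin (n H)
    adj-pres : ∀ i j → adj G i j ≡ true → adj H (φ i) (φ j) ≡ true
    sign-pres : ∀ (x : Fin (n G)) (r : List (Fin (n G))) →
                IsWalk (adj G) (closedSeq x r) →
                walkSign (σ G) (closedSeq x r) ≡ walkSign (σ H) (map φ (closedSeq x r))

-- (K₆, M): vertices 0..5 (paper's 1..6), all pairs adjacent, negative edges
-- exactly {0,1},{2,3},{4,5} (paper's 12,34,56), i.e. distinct i,j with ⌊i/2⌋ = ⌊j/2⌋.
K6M-adj : Fin 6 → Fin 6 → Bool
K6M-adj i j = not ⌊ toℕ i ≟ toℕ j ⌋

K6M-σ : Fin 6 → Fin 6 → Sign
K6M-σ i j with ⌊ toℕ i ≟ toℕ j ⌋ | ⌊ (toℕ i / 2) ≟ (toℕ j / 2) ⌋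
... | false | true = neg
... | _     | _    = pos

K6M-adj-sym : ∀ i j → K6M-adj i j ≡ K6M-adj j i
K6M-adj-sym zero zero = refl
K6M-adj-sym zero (suc zero) = refl
K6M-adj-sym zero (suc (suc zero)) = refl
K6M-adj-sym zero (suc (suc (suc zero))) = refl
K6M-adj-sym zero (suc (suc (suc (suc zero)))) = refl
K6M-adj-sym zero (suc (suc (suc (suc (suc zero))))) = refl
K6M-adj-sym (suc zero) zero = refl
K6M-adj-sym (suc zero) (suc zero) = refl
K6M-adj-sym (suc zero) (suc (suc zero)) = refl
K6M-adj-sym (suc zero) (suc (suc (suc zero))) = refl
K6M-adj-sym (suc zero) (suc (suc (suc (suc zero)))) = refl
K6M-adj-sym (suc zero) (suc (suc (suc (suc (suc zero))))) = refl
K6M-adj-sym (suc (suc zero)) zero = refl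
K6M-adj-sym (suc (suc zero)) (suc zero) = refl
K6M-adj-sym (suc (suc zero)) (suc (suc zero)) = refl
K6M-adj-sym (suc (suc zero)) (suc (suc (suc zero))) = refl
K6M-adj-sym (suc (suc zero)) (suc (suc (suc (suc zero)))) = refl
K6M-adj-sym (suc (suc zero)) (suc (suc (suc (suc (suc zero))))) = refl
K6M-adj-sym (suc (suc (suc zero))) zero = refl
K6M-adj-sym (suc (suc (suc zero))) (suc zero) = refl
K6M-adj-sym (suc (suc (suc zero))) (suc (suc zero)) = refl
K6M-adj-sym (suc (suc (suc zero))) (suc (suc (suc zero))) = refl
K6M-adj-sym (suc (suc (suc zero))) (suc (suc (suc (suc zero)))) = refl
K6M-adj-sym (suc (suc (suc zero))) (suc (suc (suc (suc (suc zero))))) = refl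
K6M-adj-sym (suc (suc (suc (suc zero)))) zero = refl
K6M-adj-sym (suc (suc (suc (suc zero)))) (suc zero) = refl
K6M-adj-sym (suc (suc (suc (suc zero)))) (suc (suc zero)) = refl
K6M-adj-sym (suc (suc (suc (suc zero)))) (suc (suc (suc zero))) = refl
K6M-adj-sym (suc (suc (suc (suc zero)))) (suc (suc (suc (suc zero)))) = refl
K6M-adj-sym (suc (suc (suc (suc zero)))) (suc (suc (suc (suc (suc zero))))) = refl
K6M-adj-sym (suc (suc (suc (suc (suc zero))))) zero = refl
K6M-adj-sym (suc (suc (suc (suc (suc zero))))) (suc zero) = refl
K6M-adj-sym (suc (suc (suc (suc (suc zero))))) (suc (suc zero)) = refl
K6M-adj-sym (suc (suc (suc (suc (suc zero))))) (suc (suc (suc zero))) = refl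
K6M-adj-sym (suc (suc (suc (suc (suc zero))))) (suc (suc (suc (suc zero)))) = refl
K6M-adj-sym (suc (suc (suc (suc (suc zero))))) (suc (suc (suc (suc (suc zero))))) = refl

K6M-adj-irr : ∀ i → K6M-adj i i ≡ false
K6M-adj-irr zero = refl
K6M-adj-irr (suc zero) = refl
K6M-adj-irr (suc (suc zero)) = refl
K6M-adj-irr (suc (suc (suc zero))) = refl
K6M-adj-irr (suc (suc (suc (suc zero)))) = refl
K6M-adj-irr (suc (suc (suc (suc (suc zero))))) = refl

K6M-σ-sym : ∀ i j → K6M-σ i j ≡ K6M-σ j i
K6M-σ-sym zero zero = refl
K6M-σ-sym zero (suc zero) = refl
K6M-σ-sym zero (suc (suc zero)) = refl
K6M-σ-sym zero (suc (suc (suc zero))) = refl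
K6M-σ-sym zero (suc (suc (suc (suc zero)))) = refl
K6M-σ-sym zero (suc (suc (suc (suc (suc zero))))) = refl
K6M-σ-sym (suc zero) zero = refl
K6M-σ-sym (suc zero) (suc zero) = refl
K6M-σ-sym (suc zero) (suc (suc zero)) = refl
K6M-σ-sym (suc zero) (suc (suc (suc zero))) = refl
K6M-σ-sym (suc zero) (suc (suc (suc (suc zero)))) = refl
K6M-σ-sym (suc zero) (suc (suc (suc (suc (suc zero))))) = refl
K6M-σ-sym (suc (suc zero)) zero = refl
K6M-σ-sym (suc (suc zero)) (suc zero) = refl
K6M-σ-sym (suc (suc zero)) (suc (suc zero)) = refl
K6M-σ-sym (suc (suc zero)) (suc (suc (suc zero))) = refl
K6M-σ-sym (suc (suc zero)) (suc (suc (suc (suc zero)))) = refl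
K6M-σ-sym (suc (suc zero)) (suc (suc (suc (suc (suc zero))))) = refl
K6M-σ-sym (suc (suc (suc zero))) zero = refl
K6M-σ-sym (suc (suc (suc zero))) (suc zero) = refl
K6M-σ-sym (suc (suc (suc zero))) (suc (suc zero)) = refl
K6M-σ-sym (suc (suc (suc zero))) (suc (suc (suc zero))) = refl
K6M-σ-sym (suc (suc (suc zero))) (suc (suc (suc (suc zero)))) = refl
K6M-σ-sym (suc (suc (suc zero))) (suc (suc (suc (suc (suc zero))))) = refl
K6M-σ-sym (suc (suc (suc (suc zero)))) zero = refl
K6M-σ-sym (suc (suc (suc (suc zero)))) (suc zero) = refl
K6M-σ-sym (suc (suc (suc (suc zero)))) (suc (suc zero)) = refl
K6M-σ-sym (suc (suc (suc (suc zero)))) (suc (suc (suc zero))) = refl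
K6M-σ-sym (suc (suc (suc (suc zero)))) (suc (suc (suc (suc zero)))) = refl
K6M-σ-sym (suc (suc (suc (suc zero)))) (suc (suc (suc (suc (suc zero))))) = refl
K6M-σ-sym (suc (suc (suc (suc (suc zero))))) zero = refl
K6M-σ-sym (suc (suc (suc (suc (suc zero))))) (suc zero) = refl
K6M-σ-sym (suc (suc (suc (suc (suc zero))))) (suc (suc zero)) = refl
K6M-σ-sym (suc (suc (suc (suc (suc zero))))) (suc (suc (suc zero))) = refl
K6M-σ-sym (suc (suc (suc (suc (suc zero))))) (suc (suc (suc (suc zero)))) = refl
K6M-σ-sym (suc (suc (suc (suc (suc zero))))) (suc (suc (suc (suc (suc zero))))) = refl

K6M : SignedGraph
K6M = record
  { n = 6 ; adj = K6M-adj ; adj-sym = K6M-adj-sym ; adj-irr = K6M-adj-irr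
  ; σ = K6M-σ ; σ-sym = K6M-σ-sym }

countTrue : List Bool → ℕ
countTrue []           = ℕ.zero
countTrue (true ∷ bs)  = ℕ.suc (countTrue bs)
countTrue (false ∷ bs) = countTrue bs

record Subgraph (G : SignedGraph) : Set where
  field
    vs     : Fin (n G) → Bool
    es     : Fin (n G) → Fin (n G) → Bool
    es-sym : ∀ i j → es i j ≡ es j i
    es-adj : ∀ i j → es i j ≡ true → adj G i j ≡ true
    es-vs  : ∀ i j → es i j ≡ true → vs i ≡ true

open Subgraph public

|V| : ∀ {G} → Subgraph G → ℕ
|V| {G} H = countTrue (map (vs H) (allFin (n G)))

-- each edge {i,j} counted once, via the ordered pair with i < j
|E| : ∀ {G} → Subgraph G → ℕ
|E| {G} H = countTrue (concatMap (λ i → map (λ j → (toℕ i <ᵇ toℕ j) ∧ es H i j) (allFin (n G))) (allFin (n G)))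

-- mad(G) = p / q  (q > 0), i.e. the maximum of 2|E(H)|/|V(H)| over nonempty
-- subgraphs H equals p/q: every such ratio is ≤ p/q and some one equals p/q
-- (cross-multiplied to stay in ℕ).
MadEq : SignedGraph → ℕ → ℕ → Set
MadEq G p q =
  (∀ (H : Subgraph G) → 0 < |V| H → q * (2 * |E| H) ≤ p * |V| H)
  × Σ (Subgraph G) (λ H → (0 < |V| H) × (q * (2 * |E| H) ≡ p * |V| H))

-- The witness W has vertices 0 … 4: two positive triangles 012 and 013 on the common
-- edge 01, and a vertex 4 joined to 2 and 3, the edge 34 being the only negative one.
-- W has 5 vertices and 7 edges, and every proper subgraph is sparser, so mad W = 14/5.
-- In (K₆, M) a triangle is positive exactly when it avoids M, so a homomorphism
-- φ : W → (K₆, M) sends the apexes 2 and 3 into the M-pair missed by φ0 and φ1.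
-- Then the walk φ2 φ4 φ3 is positive (it either retraces one edge or has both edges
-- leaving that pair), so the image of the negative 4-cycle 0 2 4 3 is positive.
module Submission where

open import Defs
open import Data.Bool using (Bool; true; false; _∧_; _∨_; if_then_else_)
open import Data.Bool.Properties using (∨-comm; ∧-comm) renaming (_≟_ to _≟ᵇ_)
open import Data.Bool.ListAction using (any)
open import Data.Fin using (Fin; toℕ; zero; suc)
open import Data.Fin.Properties using (all?) renaming (_≟_ to _≟ᶠ_)
open import Data.List using (List; []; _∷_; _++_; map; concatMap; allFin)
open import Data.Nat using (ℕ; suc; _+_; _*_; _≤_; _<_; _<ᵇ_; _/_; z≤n; s≤s)
open import Data.Nat.Properties using (≤-trans; +-mono-≤; *-monoʳ-≤; m≤n⇒m≤1+n; _<?_; _≤?_)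
  renaming (_≟_ to _≟ⁿ_)
open import Data.Product using (Σ; _×_; _,_; proj₂)
open import Data.Unit using (tt)
open import Data.Vec using (_∷_; []; lookup)
open import Relation.Binary.PropositionalEquality
  using (_≡_; _≢_; refl; sym; trans; cong; cong₂; module ≡-Reasoning)
open import Relation.Nullary using (¬_; Dec; yes; no; map′; _×-dec_; _→-dec_; from-yes)
open import Relation.Nullary.Decidable using (⌊_⌋)
open import Relation.Unary using (Decidable)

_≟ˢ_ : (s t : Sign) → Dec (s ≡ t)
pos ≟ˢ pos = yes refl
neg ≟ˢ neg = yes refl
pos ≟ˢ neg = no λ ()
neg ≟ˢ pos = no λ ()

Bool-all? : ∀ {p} {P : Bool → Set p} → Decidable P → Dec (∀ b → P b)
Bool-all? P? = map′ (λ (t , f) → λ { true → t ; false → f }) (λ ∀P → ∀P true , ∀P false)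
                    (P? true ×-dec P? false)

isWalk? : ∀ {n} (adj' : Fin n → Fin n → Bool) (xs : List (Fin n)) → Dec (IsWalk adj' xs)
isWalk? adj' []          = yes tt
isWalk? adj' (x ∷ [])    = yes tt
isWalk? adj' (x ∷ y ∷ r) = (adj' x y ≟ᵇ true) ×-dec isWalk? adj' (y ∷ r)

countTrue-++ : ∀ xs ys → countTrue (xs ++ ys) ≡ countTrue xs + countTrue ys
countTrue-++ []           ys = refl
countTrue-++ (true ∷ xs)  ys = cong suc (countTrue-++ xs ys)
countTrue-++ (false ∷ xs) ys = countTrue-++ xs ys

countTrue-map-mono : ∀ {A : Set} {f g : A → Bool} → (∀ x → f x ≡ true → g x ≡ true) →
                     ∀ xs → countTrue (map f xs) ≤ countTrue (map g xs)
countTrue-map-mono             f⇒g []       = z≤n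
countTrue-map-mono {f = f} {g} f⇒g (x ∷ xs) with f x in fx | g x in gx
... | true  | true  = s≤s (countTrue-map-mono f⇒g xs)
... | true  | false with () ← trans (sym gx) (f⇒g x fx)
... | false | true  = m≤n⇒m≤1+n (countTrue-map-mono f⇒g xs)
... | false | false = countTrue-map-mono f⇒g xs

countTrue-concatMap-mono : ∀ {A B : Set} {f g : A → B → Bool} → (∀ x y → f x y ≡ true → g x y ≡ true) →
                           ∀ ys xs → countTrue (concatMap (λ x → map (f x) ys) xs)
                                   ≤ countTrue (concatMap (λ x → map (g x) ys) xs)
countTrue-concatMap-mono         f⇒g ys []       = z≤n
countTrue-concatMap-mono {f = f} {g} f⇒g ys (x ∷ xs)
  rewrite countTrue-++ (map (f x) ys) (concatMap (λ x → map (f x) ys) xs)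
        | countTrue-++ (map (g x) ys) (concatMap (λ x → map (g x) ys) xs)
  = +-mono-≤ (countTrue-map-mono (f⇒g x) ys) (countTrue-concatMap-mono f⇒g ys xs)

∧-intro : ∀ {x y} → x ≡ true → y ≡ true → x ∧ y ≡ true
∧-intro refl refl = refl

∧-elimʳ : ∀ x {y} → x ∧ y ≡ true → y ≡ true
∧-elimʳ true p = p

∧-elimˡ : ∀ {x y} → x ∧ y ≡ true → x ≡ true
∧-elimˡ {true} p = refl

induced : (G : SignedGraph) → (Fin (n G) → Bool) → Subgraph G
induced G S = record
  { vs     = S
  ; es     = λ i j → adj G i j ∧ (S i ∧ S j)
  ; es-sym = λ i j → cong₂ _∧_ (adj-sym G i j) (∧-comm (S i) (S j))
  ; es-adj = λ i j → ∧-elimˡ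
  ; es-vs  = λ i j p → ∧-elimˡ (∧-elimʳ (adj G i j) p)
  }

|E|≤|E|-induced : ∀ {G} (H : Subgraph G) → |E| H ≤ |E| (induced G (vs H))
|E|≤|E|-induced {G} H = countTrue-concatMap-mono edge⇒inducedEdge (allFin (n G)) (allFin (n G))
  where
  edge⇒inducedEdge : ∀ i j → (toℕ i <ᵇ toℕ j) ∧ es H i j ≡ true →
                     (toℕ i <ᵇ toℕ j) ∧ (adj G i j ∧ (vs H i ∧ vs H j)) ≡ true
  edge⇒inducedEdge i j p with toℕ i <ᵇ toℕ j
  ... | true = ∧-intro (es-adj H i j p) (∧-intro (es-vs H i j p) (es-vs H j i (trans (es-sym H j i) p)))

-- |V| H and |V| (induced G (vs H)) are the same term, so only induced subgraphs matter.
madUpper-induced : ∀ G p q →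
  (∀ S → 0 < |V| (induced G S) → q * (2 * |E| (induced G S)) ≤ p * |V| (induced G S)) →
  ∀ (H : Subgraph G) → 0 < |V| H → q * (2 * |E| H) ≤ p * |V| H
madUpper-induced G p q bound H nonempty =
  ≤-trans (*-monoʳ-≤ q (*-monoʳ-≤ 2 (|E|≤|E|-induced H))) (bound (vs H) nonempty)

module _ {n : ℕ} where

  joins : Fin n × Fin n → Fin n → Fin n → Bool
  joins (a , b) i j = (⌊ a ≟ᶠ i ⌋ ∧ ⌊ b ≟ᶠ j ⌋) ∨ (⌊ a ≟ᶠ j ⌋ ∧ ⌊ b ≟ᶠ i ⌋)

  occurs : List (Fin n × Fin n) → Fin n → Fin n → Bool
  occurs es i j = any (λ e → joins e i j) es

  occurs-sym : ∀ es i j → occurs es i j ≡ occurs es j i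
  occurs-sym []             i j = refl
  occurs-sym ((a , b) ∷ es) i j =
    cong₂ _∨_ (∨-comm (⌊ a ≟ᶠ i ⌋ ∧ ⌊ b ≟ᶠ j ⌋) (⌊ a ≟ᶠ j ⌋ ∧ ⌊ b ≟ᶠ i ⌋)) (occurs-sym es i j)

  signFromNegatives : List (Fin n × Fin n) → Fin n → Fin n → Sign
  signFromNegatives negatives i j = if occurs negatives i j then neg else pos

fromEdgeLists : ∀ n (edges negatives : List (Fin n × Fin n)) →
                (∀ i → occurs edges i i ≡ false) → SignedGraph
fromEdgeLists n edges negatives loopless = record
  { n       = n
  ; adj     = occurs edges
  ; adj-sym = occurs-sym edges
  ; adj-irr = loopless
  ; σ       = signFromNegatives negatives
  ; σ-sym   = λ i j → cong (if_then neg else pos) (occurs-sym negatives i j)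
  }

w₀ w₁ w₂ w₃ w₄ : Fin 5
w₀ = zero
w₁ = suc zero
w₂ = suc (suc zero)
w₃ = suc (suc (suc zero))
w₄ = suc (suc (suc (suc zero)))

W-edges : List (Fin 5 × Fin 5)
W-edges = (w₀ , w₁) ∷ (w₀ , w₂) ∷ (w₁ , w₂) ∷ (w₀ , w₃) ∷ (w₁ , w₃) ∷ (w₂ , w₄) ∷ (w₄ , w₃) ∷ []

W : SignedGraph
W = fromEdgeLists 5 W-edges ((w₄ , w₃) ∷ [])
                  (from-yes (all? λ i → occurs W-edges i i ≟ᵇ false))

-- Both sides only see S through its five values, so S may be replaced by the table of
-- those values; the 32 tables are then checked by evaluation.
W-sparse : ∀ S → 0 < |V| (induced W S) → 5 * (2 * |E| (induced W S)) ≤ 14 * |V| (induced W S)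
W-sparse S = sparse (S w₀) (S w₁) (S w₂) (S w₃) (S w₄)
  where
  sparse : ∀ a b c d e → let H = induced W (lookup (a ∷ b ∷ c ∷ d ∷ e ∷ [])) in
           0 < |V| H → 5 * (2 * |E| H) ≤ 14 * |V| H
  sparse = from-yes (Bool-all? λ a → Bool-all? λ b → Bool-all? λ c → Bool-all? λ d → Bool-all? λ e →
             let H = induced W (lookup (a ∷ b ∷ c ∷ d ∷ e ∷ [])) in
             (0 <? |V| H) →-dec (5 * (2 * |E| H) ≤? 14 * |V| H))

W-mad : MadEq W 14 5
W-mad = madUpper-induced W 14 5 W-sparse , induced W (λ _ → true) , s≤s z≤n , refl

triangle : ∀ {n} → Fin n → Fin n → Fin n → List (Fin n)
triangle a b c = closedSeq a (b ∷ c ∷ [])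

PositiveTriangle : (G : SignedGraph) → Fin (n G) → Fin (n G) → Fin (n G) → Set
PositiveTriangle G a b c = IsWalk (adj G) (triangle a b c) × walkSign (σ G) (triangle a b c) ≡ pos

positiveTriangle? : ∀ G a b c → Dec (PositiveTriangle G a b c)
positiveTriangle? G a b c = isWalk? (adj G) (triangle a b c) ×-dec (walkSign (σ G) (triangle a b c) ≟ˢ pos)

module _ {G H : SignedGraph} (h : Hom G H) where
  open Hom h

  Hom-walk : ∀ xs → IsWalk (adj G) xs → IsWalk (adj H) (map φ xs)
  Hom-walk []          _         = tt
  Hom-walk (x ∷ [])    _         = tt
  Hom-walk (x ∷ y ∷ r) (xy , yr) = adj-pres x y xy , Hom-walk (y ∷ r) yr

  Hom-positiveTriangle : ∀ {a b c} → PositiveTriangle G a b c → PositiveTriangle H (φ a) (φ b) (φ c)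
  Hom-positiveTriangle {a} {b} {c} (walk , positive) =
    Hom-walk (triangle a b c) walk , trans (sym (sign-pres a (b ∷ c ∷ []) walk)) positive

-- The M-pair of a vertex of (K₆, M): i and j are joined by an edge of M iff i ≢ j and pair i ≡ pair j.
pair : Fin 6 → ℕ
pair i = toℕ i / 2

K6M-positiveTriangle⇒positiveEdges : ∀ a b c → PositiveTriangle K6M a b c →
  K6M-σ a b ≡ pos × K6M-σ b c ≡ pos × K6M-σ c a ≡ pos
K6M-positiveTriangle⇒positiveEdges = from-yes (all? λ a → all? λ b → all? λ c →
  positiveTriangle? K6M a b c →-dec
  (K6M-σ a b ≟ˢ pos ×-dec K6M-σ b c ≟ˢ pos ×-dec K6M-σ c a ≟ˢ pos))

K6M-positiveTriangles⇒samePair : ∀ a b c d → PositiveTriangle K6M a b c → PositiveTriangle K6M a b d →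
  pair c ≡ pair d
K6M-positiveTriangles⇒samePair = from-yes (all? λ a → all? λ b → all? λ c → all? λ d →
  positiveTriangle? K6M a b c →-dec positiveTriangle? K6M a b d →-dec (pair c ≟ⁿ pair d))

K6M-samePair⇒positivePath : ∀ a b c → pair a ≡ pair c → IsWalk K6M-adj (a ∷ b ∷ c ∷ []) →
  walkSign K6M-σ (a ∷ b ∷ c ∷ []) ≡ pos
K6M-samePair⇒positivePath = from-yes (all? λ a → all? λ b → all? λ c →
  (pair a ≟ⁿ pair c) →-dec isWalk? K6M-adj (a ∷ b ∷ c ∷ []) →-dec
  (walkSign K6M-σ (a ∷ b ∷ c ∷ []) ≟ˢ pos))

K6M-square-positive : ∀ a b c d e → PositiveTriangle K6M a b c → PositiveTriangle K6M a b d →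
  IsWalk K6M-adj (c ∷ e ∷ d ∷ []) → walkSign K6M-σ (closedSeq a (c ∷ e ∷ d ∷ [])) ≡ pos
K6M-square-positive a b c d e abc abd ced = begin
  K6M-σ a c · (K6M-σ c e · (K6M-σ e d · (K6M-σ d a · pos)))
    ≡⟨ cong₂ (λ s t → s · (K6M-σ c e · (K6M-σ e d · (t · pos)))) ac-positive da-positive ⟩
  walkSign K6M-σ (c ∷ e ∷ d ∷ [])
    ≡⟨ K6M-samePair⇒positivePath c e d (K6M-positiveTriangles⇒samePair a b c d abc abd) ced ⟩
  pos ∎
  where
  open ≡-Reasoning
  ac-positive : K6M-σ a c ≡ pos
  ac-positive = trans (K6M-σ-sym a c) (proj₂ (proj₂ (K6M-positiveTriangle⇒positiveEdges a b c abc)))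
  da-positive : K6M-σ d a ≡ pos
  da-positive = proj₂ (proj₂ (K6M-positiveTriangle⇒positiveEdges a b d abd))

W-noHom : ¬ Hom W K6M
W-noHom h = neg≢pos (begin
  neg
    ≡⟨ sign-pres w₀ (w₂ ∷ w₄ ∷ w₃ ∷ []) (refl , refl , refl , refl , tt) ⟩
  walkSign K6M-σ (closedSeq (φ w₀) (φ w₂ ∷ φ w₄ ∷ φ w₃ ∷ []))
    ≡⟨ K6M-square-positive (φ w₀) (φ w₁) (φ w₂) (φ w₃) (φ w₄)
         (Hom-positiveTriangle h ((refl , refl , refl , tt) , refl))
         (Hom-positiveTriangle h ((refl , refl , refl , tt) , refl))
         (Hom-walk h (w₂ ∷ w₄ ∷ w₃ ∷ []) (refl , refl , tt)) ⟩
  pos ∎)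
  where
  open Hom h
  open ≡-Reasoning
  neg≢pos : neg ≢ pos
  neg≢pos ()

proposition7p1 : Σ SignedGraph (λ G → MadEq G 14 5 × ¬ (Hom G K6M))
proposition7p1 = W , W-mad , W-noHom
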